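{- Let $F(x)\in\mathbb{Z}[x]$ have positive leading coefficient, and let $n_F$ be a positive integer such that whenever $a>n_F$ and $1\le b<a$ we have $F(b)<F(a)$ and $F(a)>0$. For integers $a,b,N$ let $\mathrm{Block}_F(a,b;N)$ be the set of $(a,h)\in\{1,\dots,N\}^2$ for which there exists $k\in\mathbb{Z}$ such that $(b,k)$ blocks $(a,h)$ from being visible along $F$. If $a,b\in\mathbb{Z}_{>0}$ satisfy $n_F<b<a\le N$, then $$\#\mathrm{Block}_F(a,b;N)\le N\,\frac{\gcd(F(a),F(b))}{F(a)}.$$
   Context: A point $(b,k)$ blocks $(a,h)$ from being visible along $F(x)$ if $b<a$ and there exists $t\in\mathbb{Q}$ with $h=t\,F(a)$ and $k=t\,F(b)$. -}

module Defs where

open import Data.Integer using (ℤ; +_; _+_; _*_; _<_; _≤_)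
open import Data.List using (List; []; _∷_; _∷ʳ_)
open import Data.Product using (Σ; ∃; _×_; _,_)
open import Relation.Binary.PropositionalEquality using (_≡_)
import Data.Rational as ℚ
open ℚ using (ℚ)

-- A polynomial in ℤ[x] is its list of coefficients, constant term first:
-- c₀ ∷ c₁ ∷ … ∷ cₙ represents c₀ + c₁ x + … + cₙ xⁿ.
Poly : Set
Poly = List ℤ

eval : Poly → ℤ → ℤ
eval []       x = + 0
eval (c ∷ cs) x = c + x * eval cs x

PositiveLeading : Poly → Set
PositiveLeading F = Σ (List ℤ) λ cs → Σ ℤ λ c → (F ≡ cs ∷ʳ c) × (+ 0 < c)

toℚ : ℤ → ℚ
toℚ z = z ℚ./ 1

Blocks : Poly → (b k a h : ℤ) → Set
Blocks F b k a h =
  (b < a) × ∃ λ (t : ℚ) →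
     (toℚ h ≡ t ℚ.* toℚ (eval F a)) × (toℚ k ≡ t ℚ.* toℚ (eval F b))

InBlock : Poly → (a b N : ℤ) → ℤ × ℤ → Set
InBlock F a b N (a' , h) =
  (a' ≡ a) × (+ 1 ≤ a') × (a' ≤ N) × (+ 1 ≤ h) × (h ≤ N) × ∃ λ (k : ℤ) → Blocks F b k a' h

{-# OPTIONS --safe #-}
-- If (b, k) blocks (a, h) then h F(b) = k F(a), so F(a) divides h F(b) and hence
-- d = F(a) / gcd(F(a), F(b)) divides h.  All points of Block_F(a,b;N) lie on the
-- column x = a, so they are told apart by their heights, which are distinct positive
-- multiples of d not exceeding N; there are at most N / d of them.
module Submission where

open import Defs
open import Data.Integer using (ℤ; +_; _*_; _<_; _≤_)
open import Data.Integer.GCD using (gcd)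
open import Data.List using (List; length)
open import Data.List.Relation.Unary.All using (All)
open import Data.List.Relation.Unary.Unique.Propositional using (Unique)
open import Data.Product using (_×_)

open import Data.Fin.Base as Fin using (Fin; fromℕ<)
open import Data.Fin.Properties using (pigeonhole; fromℕ<-injective)
open import Data.Integer.Base using (+≤+; ∣_∣; >-nonZero)
open import Data.Integer.GCD using (gcd-zeroʳ)
import Data.Integer.Properties as ℤ
open import Data.List.Base using (lookup)
open import Data.List.Membership.Propositional.Properties using (∈-lookup)
import Data.List.Relation.Unary.All as All
open import Data.List.Relation.Unary.AllPairs using (_∷_)
open import Data.Nat.Base as ℕ using (ℕ; zero; suc; NonZero; ≢-nonZero)
import Data.Nat.Properties as ℕ
open import Data.Nat.Divisibility using (_∣_; divides; n∣m*n; *-cancelʳ-∣)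
open import Data.Nat.DivMod using (_/_; m/n*n≡m; m*n/n≡m; /-monoˡ-≤; m/n*n≤m)
import Data.Nat.GCD as ℕ
open import Data.Product using (∃; _,_; proj₂)
open import Data.Sum using (inj₁)
open import Data.Rational.Base as ℚ using (ℚ; ↥_; ↧_)
import Data.Rational.Properties as ℚ
open import Algebra.Bundles using (CommutativeRing)
open import Algebra.Properties.CommutativeSemigroup
  (CommutativeRing.*-commutativeSemigroup ℚ.+-*-commutativeRing) using (xy∙z≈xz∙y)
open import Relation.Nullary using (yes; no; contradiction)
open import Relation.Binary.PropositionalEquality

*-gcd[i,1] : ∀ j i → j * gcd i (+ 1) ≡ j
*-gcd[i,1] j i = trans (cong (j *_) (gcd-zeroʳ i)) (ℤ.*-identityʳ j)

↥-toℚ : ∀ i → ↥ toℚ i ≡ i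
↥-toℚ i = trans (sym (*-gcd[i,1] (↥ toℚ i) i)) (ℚ.↥-/ i 1)

↧-toℚ : ∀ i → ↧ toℚ i ≡ + 1
↧-toℚ i = trans (sym (*-gcd[i,1] (↧ toℚ i) i)) (ℚ.↧-/ i 1)

↥-toℚ-* : ∀ i j → ↥ (toℚ i ℚ.* toℚ j) ≡ i * j
↥-toℚ-* i j = begin
  ↥ (toℚ i ℚ.* toℚ j)
    ≡⟨ *-gcd[i,1] _ (↥ toℚ i * ↥ toℚ j) ⟨
  ↥ (toℚ i ℚ.* toℚ j) * gcd (↥ toℚ i * ↥ toℚ j) (+ 1 * + 1)
    ≡⟨ cong (λ c → ↥ (toℚ i ℚ.* toℚ j) * gcd (↥ toℚ i * ↥ toℚ j) c)
            (cong₂ _*_ (↧-toℚ i) (↧-toℚ j)) ⟨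
  ↥ (toℚ i ℚ.* toℚ j) * gcd (↥ toℚ i * ↥ toℚ j) (↧ toℚ i * ↧ toℚ j)
    ≡⟨ ℚ.↥-* (toℚ i) (toℚ j) ⟩
  ↥ toℚ i * ↥ toℚ j
    ≡⟨ cong₂ _*_ (↥-toℚ i) (↥-toℚ j) ⟩
  i * j ∎
  where open ≡-Reasoning

toℚ-proportional⇒cross-≡ : ∀ {h k A B} (t : ℚ) →
  toℚ h ≡ t ℚ.* toℚ A → toℚ k ≡ t ℚ.* toℚ B → h * B ≡ k * A
toℚ-proportional⇒cross-≡ {h} {k} {A} {B} t h≡tA k≡tB = begin
  h * B                       ≡⟨ ↥-toℚ-* h B ⟨
  ↥ (toℚ h ℚ.* toℚ B)         ≡⟨ cong (λ x → ↥ (x ℚ.* toℚ B)) h≡tA ⟩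
  ↥ (t ℚ.* toℚ A ℚ.* toℚ B)   ≡⟨ cong ↥_ (xy∙z≈xz∙y t (toℚ A) (toℚ B)) ⟩
  ↥ (t ℚ.* toℚ B ℚ.* toℚ A)   ≡⟨ cong (λ x → ↥ (x ℚ.* toℚ A)) k≡tB ⟨
  ↥ (toℚ k ℚ.* toℚ A)         ≡⟨ ↥-toℚ-* k A ⟩
  k * A                       ∎
  where open ≡-Reasoning

Blocks⇒cross-≡ : ∀ F {b k a h} → Blocks F b k a h → h * eval F b ≡ k * eval F a
Blocks⇒cross-≡ F {b} {k} {a} {h} (_ , t , h≡tFa , k≡tFb) =
  toℚ-proportional⇒cross-≡ {h} {k} {eval F a} {eval F b} t h≡tFa k≡tFb

m∣n*o⇒m/gcd[m,o]∣n : ∀ {m n o} .{{_ : NonZero (ℕ.gcd m o)}} → m ∣ n ℕ.* o → m / ℕ.gcd m o ∣ n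
m∣n*o⇒m/gcd[m,o]∣n {m} {n} {o} m∣no =
  *-cancelʳ-∣ g (subst (_∣ n ℕ.* g) (sym (m/n*n≡m (ℕ.gcd[m,n]∣m m o))) m∣ng)
  where
  g = ℕ.gcd m o
  -- m divides gcd (n m) (n o) = n gcd m o
  m∣ng : m ∣ n ℕ.* g
  m∣ng = subst (m ∣_) (sym (ℕ.c*gcd[m,n]≡gcd[cm,cn] n m o)) (ℕ.gcd-greatest (n∣m*n n) m∣no)

m*n≤o⇒m≤o/n : ∀ m {n o} .{{_ : NonZero n}} → m ℕ.* n ℕ.≤ o → m ℕ.≤ o / n
m*n≤o⇒m≤o/n m {n} mn≤o = ℕ.≤-trans (ℕ.≤-reflexive (sym (m*n/n≡m m n))) (/-monoˡ-≤ n mn≤o)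

lookup-<⇒≢ : ∀ {a} {A : Set a} {xs : List A} → Unique xs →
             ∀ {i j} → i Fin.< j → lookup xs i ≢ lookup xs j
lookup-<⇒≢ (x≢xs ∷ _)    {Fin.zero}  {Fin.suc j} _           = All.lookup x≢xs (∈-lookup j)
lookup-<⇒≢ (_    ∷ uniq) {Fin.suc i} {Fin.suc j} (ℕ.s≤s i<j) = lookup-<⇒≢ uniq i<j

injective-code⇒length≤ : ∀ {a p} {A : Set a} {P : A → Set p} {n} {xs : List A}
  (code : ∀ {x} → P x → Fin n) →
  (∀ {x y} (px : P x) (py : P y) → code px ≡ code py → x ≡ y) →
  Unique xs → All P xs → length xs ℕ.≤ n
injective-code⇒length≤ {P = P} {n} {xs} code code-injective uniq pxs with length xs ℕ.≤? n
... | yes xs≤n = xs≤n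
... | no xs≰n =
  let i , j , i<j , same-code = pigeonhole (ℕ.≰⇒> xs≰n) (λ i → code (at i))
  in contradiction (code-injective (at i) (at j) same-code) (lookup-<⇒≢ uniq i<j)
  where
  at : ∀ i → P (lookup xs i)
  at i = All.lookup pxs (∈-lookup i)

ColumnMultiple : ℤ → (d M : ℕ) → ℤ × ℤ → Set
ColumnMultiple a d M (x , h) = x ≡ a × ∃ λ q → h ≡ + (suc q ℕ.* d) × suc q ℕ.* d ℕ.≤ M

ColumnMultiple-length≤ : ∀ {a d M S} .{{_ : NonZero d}} →
  Unique S → All (ColumnMultiple a d M) S → length S ℕ.≤ M / d
ColumnMultiple-length≤ {a} {d} {M} = injective-code⇒length≤ index index-injective
  where
  index : ∀ {p} → ColumnMultiple a d M p → Fin (M / d)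
  index (_ , q , _ , [1+q]d≤M) = fromℕ< (m*n≤o⇒m≤o/n (suc q) [1+q]d≤M)
  index-injective : ∀ {p p′} (c : ColumnMultiple a d M p) (c′ : ColumnMultiple a d M p′) →
                    index c ≡ index c′ → p ≡ p′
  index-injective (refl , q , refl , _) (refl , q′ , refl , _) same-index
    with fromℕ<-injective q q′ _ _ same-index
  ... | refl = refl

module _ (F : Poly) {a b : ℤ} where

  private
    A = ∣ eval F a ∣
    B = ∣ eval F b ∣

  blocked-height-divisible : ∀ {k h} .{{_ : NonZero (ℕ.gcd A B)}} →
    Blocks F b k a (+ h) → A / ℕ.gcd A B ∣ h
  blocked-height-divisible {k} {h} blocks = m∣n*o⇒m/gcd[m,o]∣n (divides ∣ k ∣ (begin
    h ℕ.* B                  ≡⟨ ℤ.abs-* (+ h) (eval F b) ⟨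
    ∣ + h * eval F b ∣       ≡⟨ cong ∣_∣ (Blocks⇒cross-≡ F {b} {k} {a} {+ h} blocks) ⟩
    ∣ k * eval F a ∣         ≡⟨ ℤ.abs-* k (eval F a) ⟩
    ∣ k ∣ ℕ.* A              ∎))
    where open ≡-Reasoning

  InBlock⇒ColumnMultiple : ∀ {N p} .{{_ : NonZero (ℕ.gcd A B)}} →
    InBlock F a b N p → ColumnMultiple a (A / ℕ.gcd A B) ∣ N ∣ p
  InBlock⇒ColumnMultiple (refl , _ , _ , +≤+ {n = h} 1≤h , +≤+ h≤N , k , blocks)
    with blocked-height-divisible {k} {h} blocks
  ... | divides zero    h≡0      = contradiction h≡0 (ℕ.n>0⇒n≢0 1≤h)
  ... | divides (suc q) h≡[1+q]d = refl , q , cong +_ h≡[1+q]d , subst (ℕ._≤ _) h≡[1+q]d h≤N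

  InBlock-length*≤ : ∀ {N S} .{{_ : NonZero A}} → Unique S → All (InBlock F a b N) S →
    length S ℕ.* A ℕ.≤ ∣ N ∣ ℕ.* ℕ.gcd A B
  InBlock-length*≤ {N} {S} uniq inBlock = begin
    length S ℕ.* A          ≡⟨ cong (length S ℕ.*_) (m/n*n≡m (ℕ.gcd[m,n]∣m A B)) ⟨
    length S ℕ.* (d ℕ.* g)  ≡⟨ ℕ.*-assoc (length S) d g ⟨
    length S ℕ.* d ℕ.* g    ≤⟨ ℕ.*-monoˡ-≤ g (ℕ.*-monoˡ-≤ d length≤N/d) ⟩
    ∣ N ∣ / d ℕ.* d ℕ.* g   ≤⟨ ℕ.*-monoˡ-≤ g (m/n*n≤m ∣ N ∣ d) ⟩
    ∣ N ∣ ℕ.* g             ∎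
    where
    open ℕ.≤-Reasoning
    g = ℕ.gcd A B
    d = A / g
    instance
      g≢0 : NonZero g
      g≢0 = ≢-nonZero (ℕ.gcd[m,n]≢0 A B (inj₁ (ℕ.≢-nonZero⁻¹ A)))
      d≢0 : NonZero d
      d≢0 = ≢-nonZero (ℕ.m/gcd[m,n]≢0 A B)
    length≤N/d : length S ℕ.≤ ∣ N ∣ / d
    length≤N/d = ColumnMultiple-length≤ uniq (All.map InBlock⇒ColumnMultiple inBlock)

*-≤-fromℕ : ∀ m n {i j} → + 0 ≤ i → + 0 ≤ j → m ℕ.* ∣ i ∣ ℕ.≤ ∣ j ∣ ℕ.* n → + m * i ≤ j * + n
*-≤-fromℕ m n (+≤+ {n = i} _) (+≤+ {n = j} _) m∣i∣≤∣j∣n =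
  subst₂ _≤_ (ℤ.pos-* m i) (ℤ.pos-* j n) (+≤+ m∣i∣≤∣j∣n)

lemma2p3 : (F : Poly) → PositiveLeading F →
    (nF : ℤ) → + 0 < nF →
    (∀ a b → nF < a → + 1 ≤ b → b < a → (eval F b < eval F a) × (+ 0 < eval F a)) →
    (a b N : ℤ) → nF < b → b < a → a ≤ N →
    (S : List (ℤ × ℤ)) → Unique S → All (InBlock F a b N) S →
    + length S * eval F a ≤ N * gcd (eval F a) (eval F b)
lemma2p3 F _ nF 0<nF mono a b N nF<b b<a a≤N S uniq inBlock =
  *-≤-fromℕ (length S) _ (ℤ.<⇒≤ 0<Fa) (ℤ.<⇒≤ (ℤ.<-≤-trans 0<a a≤N))
    (InBlock-length*≤ F uniq inBlock)
  where
  0<b : + 0 < b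
  0<b = ℤ.<-trans 0<nF nF<b
  0<a : + 0 < a
  0<a = ℤ.<-trans 0<b b<a
  0<Fa : + 0 < eval F a
  0<Fa = proj₂ (mono a b (ℤ.<-trans nF<b b<a) (ℤ.i<j⇒suc[i]≤j 0<b) b<a)
  instance
    Fa≢0 : NonZero ∣ eval F a ∣
    Fa≢0 = >-nonZero 0<Fa
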